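{- Let $T$ be an eligible tenacity and assume $B(w)$ is a singleton for every vertex $w$ with $t_m\le\mathrm{t}(w)\le T$. Let $b$ be an outer vertex and let $t\le t'\le T$ be odd with $t'<\mathrm{t}(b)$ and $t'<l_m$, and let $\mathcal{B}_{b,t}$ and $\mathcal{B}_{b,t'}$ be the two blossoms with base $b$. Then $\mathcal{B}_{b,t}\subseteq\mathcal{B}_{b,t'}$.
   Context: $G=(V,E)$ is a finite undirected graph with matching $M$; alternating paths alternate matched/unmatched edges; $l_m$ is the minimum length of an alternating path between two distinct unmatched vertices ($\infty$ if none). $\mathrm{evenlevel}(v)$ ($\mathrm{oddlevel}(v)$) is the length of a minimum even (odd) length alternating path from some unmatched vertex to $v$ ($\infty$ if none). $v$ is outer if $\mathrm{evenlevel}(v)<\mathrm{oddlevel}(v)$. Tenacity $\mathrm{t}(v)=\mathrm{evenlevel}(v)+\mathrm{oddlevel}(v)$; $t_m$ is the minimum tenacity; odd $t$ with $t_m\le t<l_m$ is eligible. For $v$ of eligible tenacity $t$ and $p$ an evenlevel$(v)$ or oddlevel$(v)$ path starting at unmatched $f$, $F(p,v)$ is the vertex of tenacity $>t$ on $p$ farthest from $f$; $B(v)$ is the set of all $F(p,v)$; if singleton, its element is $\mathrm{base}(v)$. Blossoms: for outer $b$ and odd $t\le T$ with $\mathrm{t}(b)>t$: $\mathcal{B}_{b,1}=\emptyset$, $S_{b,t}=\{v:\mathrm{t}(v)=t,\mathrm{base}(v)=b\}$, $\mathcal{B}_{b,t}=S_{b,t}\cup\bigcup_{w\in S_{b,t}\cup\{b\},\,w\text{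 outer}}\mathcal{B}_{w,t-2}$. -}

module Defs where

open import Level using (0ℓ)
open import Data.Nat using (ℕ; zero; suc; _+_; _*_; _≤_; _<_)
open import Data.Fin using (Fin)
open import Data.Bool using (Bool; true; false; not)
open import Data.Maybe using (Maybe; just; nothing)
open import Data.List using (List; []; _∷_; _++_; head; last; length)
open import Data.List.Relation.Unary.All using (All)
open import Data.List.Relation.Unary.Unique.Propositional using (Unique)
open import Data.Product using (Σ; ∃; _×_; _,_)
open import Data.Sum using (_⊎_)
open import Data.Empty using (⊥)
open import Data.Unit using (⊤)
open import Relation.Nullary using (¬_)
open import Relation.Binary.PropositionalEquality using (_≡_; _≢_)
open import Function.Bundles using (_⇔_)

data ℕ∞ : Set where
  fin : ℕ → ℕ∞
  ∞   : ℕ∞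

_+∞_ : ℕ∞ → ℕ∞ → ℕ∞
fin a +∞ fin b = fin (a + b)
_     +∞ _     = ∞

_≤∞_ : ℕ∞ → ℕ∞ → Set
fin a ≤∞ fin b = a ≤ b
fin a ≤∞ ∞     = ⊤
∞     ≤∞ fin b = ⊥
∞     ≤∞ ∞     = ⊤

_<∞_ : ℕ∞ → ℕ∞ → Set
fin a <∞ fin b = a < b
fin a <∞ ∞     = ⊤
∞     <∞ _     = ⊥

IsEven : ℕ → Set
IsEven k = ∃ λ m → k ≡ 2 * m

IsOdd : ℕ → Set
IsOdd k = ∃ λ m → k ≡ suc (2 * m)

MinOf : (ℕ → Set) → ℕ∞ → Set
MinOf P (fin k) = P k × (∀ k' → P k' → k ≤ k')
MinOf P ∞       = ∀ k → ¬ P k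

record Setting : Set₁ where
  field
    n     : ℕ
    E     : Fin n → Fin n → Set
    E-sym : ∀ {u v} → E u v → E v u
    E-irr : ∀ {u} → ¬ E u u
    M     : Fin n → Fin n → Set
    M⊆E   : ∀ {u v} → M u v → E u v
    M-sym : ∀ {u v} → M u v → M v u
    M-fun : ∀ {u v w} → M u v → M u w → v ≡ w

module Notions (S : Setting) where
  open Setting S

  V : Set
  V = Fin n

  Unmatched : V → Set
  Unmatched v = ∀ u → ¬ M u v

  AP : Bool → List V → Set
  AP b (x ∷ y ∷ r) = E x y × (if-matched b x y) × AP (not b) (y ∷ r)
    where
    if-matched : Bool → V → V → Set
    if-matched true  x y = M x y
    if-matched false x y = ¬ M x y
  AP b _ = ⊤

  Alternating : List V → Set
  Alternating p = Σ Bool λ b → AP b p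

  IsAltPath : V → V → ℕ → List V → Set
  IsAltPath f v k p =
    head p ≡ just f × last p ≡ just v × length p ≡ suc k × Unique p × Alternating p

  LevPath : V → ℕ → List V → Set
  LevPath v k p = Σ V λ f → Unmatched f × IsAltPath f v k p

  EvenLevel : V → ℕ∞ → Set
  EvenLevel v = MinOf (λ k → IsEven k × ∃ λ p → LevPath v k p)

  OddLevel : V → ℕ∞ → Set
  OddLevel v = MinOf (λ k → IsOdd k × ∃ λ p → LevPath v k p)

  Lm : ℕ∞ → Set
  Lm = MinOf (λ k → Σ V λ f → Σ V λ g → f ≢ g × Unmatched f × Unmatched g
                   × ∃ λ p → IsAltPath f g k p)

  Outer : V → Set
  Outer v = Σ ℕ∞ λ e → Σ ℕ∞ λ o → EvenLevel v e × OddLevel v o × e <∞ o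

  Ten : V → ℕ∞ → Set
  Ten v l = Σ ℕ∞ λ e → Σ ℕ∞ λ o → EvenLevel v e × OddLevel v o × l ≡ e +∞ o

  TenGt : V → ℕ → Set
  TenGt v t = Σ ℕ∞ λ l → Ten v l × fin t <∞ l

  Tm : ℕ∞ → Set
  Tm = MinOf (λ t → Σ V λ v → Ten v (fin t))

  Eligible : ℕ∞ → ℕ∞ → ℕ → Set
  Eligible tm lm t = IsOdd t × tm ≤∞ fin t × fin t <∞ lm

  -- x = F(p,v) where t = t(v): x is the vertex of tenacity > t on p farthest
  -- from the start of p.
  F : List V → ℕ → V → Set
  F p t x = Σ (List V) λ as → Σ (List V) λ bs →
    p ≡ as ++ (x ∷ bs) × TenGt x t × All (λ y → ¬ TenGt y t) bs

  InB : V → V → Set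
  InB v x = Σ ℕ λ t → Ten v (fin t) × Σ ℕ λ k → Σ (List V) λ p →
    (EvenLevel v (fin k) ⊎ OddLevel v (fin k)) × LevPath v k p × F p t x

  Base : V → V → Set
  Base v b = ∀ x → (InB v x ⇔ (x ≡ b))

  S' : V → ℕ → V → Set
  S' b t v = Ten v (fin t) × Base v b

  -- Blossom b t v : v ∈ 𝓑_{b,t}   (meaningful for odd t; 𝓑_{b,1} = ∅)
  Blossom : V → ℕ → V → Set
  Blossom b (suc (suc (suc t))) v =
    S' b (suc (suc (suc t))) v
    ⊎ Σ V λ w → (w ≡ b ⊎ S' b (suc (suc (suc t))) w) × Outer w × Blossom w (suc t) v
  Blossom b _ v = ⊥

module Submission where

open import Defs
open import Data.Nat using (ℕ; zero; suc; _+_; _*_; _≤_; s≤s)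
open import Data.Nat.Properties using (*-cancelˡ-≤; m≤n⇒∃[o]m+o≡n)
open import Data.Nat.Tactic.RingSolver using (solve-∀)
open import Data.Product using (∃; _,_)
open import Data.Sum using (inj₁; inj₂)
open import Relation.Binary.PropositionalEquality using (_≡_; refl; subst)

-- Gaps are written k * 2 so that suc k * 2 + t reduces to 2 + (k * 2 + t).
odd-≤⇒∃[k]k*2+t≡t' : ∀ {t t'} → IsOdd t → IsOdd t' → t ≤ t' → ∃ λ k → k * 2 + t ≡ t'
odd-≤⇒∃[k]k*2+t≡t' (m , refl) (m' , refl) (s≤s 2m≤2m') with m≤n⇒∃[o]m+o≡n (*-cancelˡ-≤ {m} {m'} 2 2m≤2m')
... | k , refl = k , gap m k
  where
  gap : ∀ m k → k * 2 + suc (2 * m) ≡ suc (2 * (m + k))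
  gap = solve-∀

module _ (S : Setting) where
  open Notions S

  Blossom-step : ∀ {b} → Outer b → ∀ t {v} → Blossom b t v → Blossom b (2 + t) v
  Blossom-step ob (suc (suc (suc t))) bl = inj₂ (_ , inj₁ refl , ob , bl)

  Blossom-grow : ∀ {b} → Outer b → ∀ k t {v} → Blossom b t v → Blossom b (k * 2 + t) v
  Blossom-grow ob zero    t bl = bl
  Blossom-grow ob (suc k) t bl = Blossom-step ob (k * 2 + t) (Blossom-grow ob k t bl)

lemma7p2 : (S : Setting) → let open Notions S in
    (tm lm : ℕ∞) → Tm tm → Lm lm →
    (T : ℕ) → Eligible tm lm T →
    (∀ w l → Ten w l → tm ≤∞ l → l ≤∞ fin T → ∃ λ b → Base w b) →
    (b : V) → Outer b →
    (t t' : ℕ) → IsOdd t → IsOdd t' → t ≤ t' → t' ≤ T →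
    TenGt b t' → fin t' <∞ lm →
    ∀ v → Blossom b t v → Blossom b t' v
lemma7p2 S _ _ _ _ _ _ _ b ob t t' odd-t odd-t' t≤t' _ _ _ v bl
  with odd-≤⇒∃[k]k*2+t≡t' odd-t odd-t' t≤t'
... | k , k*2+t≡t' = subst (λ s → Notions.Blossom S b s v) k*2+t≡t' (Blossom-grow S ob k t bl)
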